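{- Let $(B,\cdot,\circ)$ be a skew left brace whose associated solution $(B,\lambda,\rho)$ is $2$-reductive. Then for all $x,y\in B$: (i) $y\circ y=y\cdot\overline{y^{ -1}}$; (ii) $(y^{ -1}\circ x)\cdot y=(\bar y\circ x)\cdot\bar y^{ -1}=\rho_y(x)$; (iii) $\bar y\cdot y=y\cdot\bar y$; (iv) $y^{ -1}\cdot\bar y^{ -1}=y^{ -1}\circ y$; (v) $y\circ y=\overline{y^{ -1}}\circ\bar y^{ -1}$; (vi) $\overline{\bar y\cdot y}=(\bar y\cdot y)^{ -1}=y^{ -1}\circ y$; (vii) $x\circ y\circ\bar x\circ\bar y=(x\circ y)\cdot(y\circ x)^{ -1}$.
   Context: A skew left brace is $(B,\cdot,\circ)$ with $(B,\cdot)$ and $(B,\circ)$ groups such that $a\circ(b\cdot c)=(a\circ b)\cdot a^{ -1}\cdot(a\circ c)$ for all $a,b,c$; $a^{ -1}$ denotes the inverse in $(B,\cdot)$ and $\bar a$ the inverse in $(B,\circ)$. The associated solution is $r(a,b)=(\lambda_a(b),\rho_b(a))$ with $\lambda_a(b)=a^{ -1}\cdot(a\circ b)$ and $\rho_b(a)=\overline{\lambda_a(b)}\circ a\circ b$. It is $2$-reductive if for all $x,y\in B$: $\lambda_{\lambda_x(y)}=\lambda_y$, $\rho_{\rho_x(y)}=\rho_y$, $\lambda_{\rho_x(y)}=\lambda_y$, $\rho_{\lambda_x(y)}=\rho_y$. -}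

module Defs where

open import Level using (Level; suc)
open import Relation.Binary.PropositionalEquality using (_≡_)
open import Algebra.Structures using (IsGroup)

record SkewBrace (ℓ : Level) : Set (suc ℓ) where
  infixl 7 _·_
  infixl 8 _∘_
  field
    B     : Set ℓ
    _·_   : B → B → B
    e     : B
    inv   : B → B
    _∘_   : B → B → B
    e∘    : B
    bar   : B → B
    isGroup·  : IsGroup _≡_ _·_ e inv
    isGroup∘  : IsGroup _≡_ _∘_ e∘ bar
    brace : ∀ a b c → a ∘ (b · c) ≡ (a ∘ b) · inv a · (a ∘ c)

  lam : B → B → B
  lam a b = inv a · (a ∘ b)

  rho : B → B → B
  rho b a = bar (lam a b) ∘ a ∘ b

  Is2Reductive : Set ℓ
  Is2Reductive =
    (∀ x y z → lam (lam x y) z ≡ lam y z) ×' 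
    ((∀ x y z → rho (rho x y) z ≡ rho y z) ×'
    ((∀ x y z → lam (rho x y) z ≡ lam y z) ×'
     (∀ x y z → rho (lam x y) z ≡ rho y z)))
    where
    open import Data.Product using () renaming (_×_ to _×'_)

{-# OPTIONS --safe #-}

-- λ is an action of (B, ∘) on (B, ·) by automorphisms, and a ∘ b = a · λ_a(b).
-- Through λ_{λ_x(y)} = λ_y this gives ρ_y(x) = λ_ȳ(u⁻¹ · x · u) with u = λ_x(y);
-- then ρ_{λ_x(y)} = ρ_y and injectivity of λ_ȳ show that λ_w(y) and y induce the
-- same inner automorphism of (B, ·).  In particular y commutes with every λ_w(y),
-- and the seven identities are group manipulations of these two facts.
module Submission where

open import Defs
open import Level using (Level)
open import Algebra.Bundles using (Group)
open import Algebra.Structures using (IsGroup)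
import Algebra.Properties.Group as GroupProperties
open import Data.Product using (_×_; _,_; proj₁; proj₂)
open import Relation.Binary.PropositionalEquality
  using (_≡_; _≗_; sym; trans; cong; cong₂; module ≡-Reasoning)
import Relation.Binary.Reasoning.Setoid as SetoidReasoning
open import Function using () renaming (_∘_ to _∘′_)

module CommutingElements {c ℓ} (G : Group c ℓ) where
  open Group G
  open GroupProperties G
  open SetoidReasoning setoid

  conj-fixed⇒comm : ∀ m y → m ⁻¹ ∙ y ∙ m ≈ y → y ∙ m ≈ m ∙ y
  conj-fixed⇒comm m y p = begin
    y ∙ m                ≈⟨ ∙-congʳ (\\-leftDividesˡ m y) ⟨
    m ∙ (m ⁻¹ ∙ y) ∙ m   ≈⟨ assoc m (m ⁻¹ ∙ y) m ⟩
    m ∙ (m ⁻¹ ∙ y ∙ m)   ≈⟨ ∙-congˡ p ⟩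
    m ∙ y                ∎

  comm⇒comm-inverse : ∀ a b → a ∙ b ≈ b ∙ a → b ⁻¹ ∙ a ≈ a ∙ b ⁻¹
  comm⇒comm-inverse a b p = begin
    b ⁻¹ ∙ a                  ≈⟨ //-rightDividesʳ b (b ⁻¹ ∙ a) ⟨
    b ⁻¹ ∙ a ∙ b ∙ b ⁻¹       ≈⟨ ∙-congʳ (assoc (b ⁻¹) a b) ⟩
    b ⁻¹ ∙ (a ∙ b) ∙ b ⁻¹     ≈⟨ ∙-congʳ (∙-congˡ p) ⟩
    b ⁻¹ ∙ (b ∙ a) ∙ b ⁻¹     ≈⟨ ∙-congʳ (\\-leftDividesʳ b a) ⟩
    a ∙ b ⁻¹                  ∎

module SkewBraceProperties {ℓ} (S : SkewBrace ℓ) where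
  open SkewBrace S
  open ≡-Reasoning

  ·-group : Group ℓ ℓ
  ·-group = record { isGroup = isGroup· }

  ∘-group : Group ℓ ℓ
  ∘-group = record { isGroup = isGroup∘ }

  module · where
    open IsGroup isGroup· public
    open GroupProperties ·-group public
    open CommutingElements ·-group public

  module ∘ where
    open IsGroup isGroup∘ public
    open GroupProperties ∘-group public

  ∘≡·lam : ∀ a b → a ∘ b ≡ a · lam a b
  ∘≡·lam a b = sym (·.\\-leftDividesˡ a (a ∘ b))

  e∘≡e : e∘ ≡ e
  e∘≡e = ·.identityˡ-unique e∘ e∘ (begin
    e∘ · e∘                          ≡⟨ ∘.identityˡ _ ⟨
    e∘ ∘ (e∘ · e∘)                   ≡⟨ brace e∘ e∘ e∘ ⟩
    (e∘ ∘ e∘) · inv e∘ · (e∘ ∘ e∘)   ≡⟨ cong (λ z → z · inv e∘ · z) (∘.identityˡ e∘) ⟩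
    e∘ · inv e∘ · e∘                 ≡⟨ cong (_· e∘) (·.inverseʳ e∘) ⟩
    e · e∘                           ≡⟨ ·.identityˡ e∘ ⟩
    e∘                               ∎)

  lam-e : ∀ a → lam a e ≡ e
  lam-e a = begin
    inv a · (a ∘ e)    ≡⟨ cong (λ z → inv a · (a ∘ z)) e∘≡e ⟨
    inv a · (a ∘ e∘)   ≡⟨ cong (inv a ·_) (∘.identityʳ a) ⟩
    inv a · a          ≡⟨ ·.inverseˡ a ⟩
    e                  ∎

  lam-· : ∀ a b c → lam a (b · c) ≡ lam a b · lam a c
  lam-· a b c = begin
    inv a · (a ∘ (b · c))                  ≡⟨ cong (inv a ·_) (brace a b c) ⟩
    inv a · ((a ∘ b) · inv a · (a ∘ c))    ≡⟨ cong (inv a ·_) (·.assoc _ _ _) ⟩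
    inv a · ((a ∘ b) · (inv a · (a ∘ c)))  ≡⟨ ·.assoc _ _ _ ⟨
    lam a b · lam a c                      ∎

  lam-inv : ∀ a b → lam a (inv b) ≡ inv (lam a b)
  lam-inv a b = ·.inverseʳ-unique (lam a b) (lam a (inv b)) (begin
    lam a b · lam a (inv b)   ≡⟨ lam-· a b (inv b) ⟨
    lam a (b · inv b)         ≡⟨ cong (lam a) (·.inverseʳ b) ⟩
    lam a e                   ≡⟨ lam-e a ⟩
    e                         ∎)

  lam-∘ : ∀ a b → lam (a ∘ b) ≗ lam a ∘′ lam b
  lam-∘ a b c = begin
    inv (a ∘ b) · ((a ∘ b) ∘ c)                      ≡⟨ cong (inv (a ∘ b) ·_) (∘.assoc a b c) ⟩
    inv (a ∘ b) · (a ∘ (b ∘ c))                      ≡⟨ cong (λ z → inv (a ∘ b) · (a ∘ z)) (∘≡·lam b c) ⟩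
    inv (a ∘ b) · (a ∘ (b · lam b c))                ≡⟨ cong (inv (a ∘ b) ·_) (brace a b (lam b c)) ⟩
    inv (a ∘ b) · ((a ∘ b) · inv a · (a ∘ lam b c))  ≡⟨ cong (inv (a ∘ b) ·_) (·.assoc _ _ _) ⟩
    inv (a ∘ b) · ((a ∘ b) · lam a (lam b c))        ≡⟨ ·.\\-leftDividesʳ _ _ ⟩
    lam a (lam b c)                                  ∎

  lam-e∘ : ∀ c → lam e∘ c ≡ c
  lam-e∘ c = begin
    inv e∘ · (e∘ ∘ c)   ≡⟨ cong (inv e∘ ·_) (∘.identityˡ c) ⟩
    inv e∘ · c          ≡⟨ cong (λ z → inv z · c) e∘≡e ⟩
    inv e · c           ≡⟨ cong (_· c) ·.ε⁻¹≈ε ⟩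
    e · c               ≡⟨ ·.identityˡ c ⟩
    c                   ∎

  lam-bar-lam : ∀ a c → lam (bar a) (lam a c) ≡ c
  lam-bar-lam a c = begin
    lam (bar a) (lam a c)   ≡⟨ lam-∘ (bar a) a c ⟨
    lam (bar a ∘ a) c       ≡⟨ cong (λ z → lam z c) (∘.inverseˡ a) ⟩
    lam e∘ c                ≡⟨ lam-e∘ c ⟩
    c                       ∎

  lam-lam-bar : ∀ a c → lam a (lam (bar a) c) ≡ c
  lam-lam-bar a c = begin
    lam a (lam (bar a) c)   ≡⟨ lam-∘ a (bar a) c ⟨
    lam (a ∘ bar a) c       ≡⟨ cong (λ z → lam z c) (∘.inverseʳ a) ⟩
    lam e∘ c                ≡⟨ lam-e∘ c ⟩
    c                       ∎

  lam-injective : ∀ a {b c} → lam a b ≡ lam a c → b ≡ c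
  lam-injective a {b} {c} p = begin
    b                       ≡⟨ lam-bar-lam a b ⟨
    lam (bar a) (lam a b)   ≡⟨ cong (lam (bar a)) p ⟩
    lam (bar a) (lam a c)   ≡⟨ lam-bar-lam a c ⟩
    c                       ∎

  lam-bar-cong : ∀ {u v} → lam u ≗ lam v → lam (bar u) ≗ lam (bar v)
  lam-bar-cong {u} {v} p z = begin
    lam (bar u) z                         ≡⟨ cong (lam (bar u)) (lam-lam-bar v z) ⟨
    lam (bar u) (lam v (lam (bar v) z))   ≡⟨ cong (lam (bar u)) (p _) ⟨
    lam (bar u) (lam u (lam (bar v) z))   ≡⟨ lam-bar-lam u _ ⟩
    lam (bar v) z                         ∎

  lam-bar≡inv : ∀ a → lam a (bar a) ≡ inv a
  lam-bar≡inv a = begin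
    inv a · (a ∘ bar a)   ≡⟨ cong (inv a ·_) (trans (∘.inverseʳ a) e∘≡e) ⟩
    inv a · e             ≡⟨ ·.identityʳ (inv a) ⟩
    inv a                 ∎

  bar≡inv-lam : ∀ a → bar a ≡ inv (lam (bar a) a)
  bar≡inv-lam a = ·.inverseˡ-unique (bar a) (lam (bar a) a) (begin
    bar a · lam (bar a) a   ≡⟨ ∘≡·lam (bar a) a ⟨
    bar a ∘ a               ≡⟨ ∘.inverseˡ a ⟩
    e∘                      ≡⟨ e∘≡e ⟩
    e                       ∎)

  inv-bar≡lam : ∀ a → inv (bar a) ≡ lam (bar a) a
  inv-bar≡lam a = trans (cong inv (bar≡inv-lam a)) (·.⁻¹-involutive _)

  conj : B → B → B
  conj u v = inv u · v · u

  lam-conj : ∀ w u v → lam w (conj u v) ≡ conj (lam w u) (lam w v)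
  lam-conj w u v = begin
    lam w (inv u · v · u)                  ≡⟨ lam-· w _ u ⟩
    lam w (inv u · v) · lam w u            ≡⟨ cong (_· lam w u) (lam-· w (inv u) v) ⟩
    lam w (inv u) · lam w v · lam w u      ≡⟨ cong (λ z → z · lam w v · lam w u) (lam-inv w u) ⟩
    conj (lam w u) (lam w v)               ∎

  rho≡lam-conj : ∀ y x → rho y x ≡ lam (bar (lam x y)) (conj (lam x y) x)
  rho≡lam-conj y x = begin
    bar u ∘ x ∘ y                            ≡⟨ ∘.assoc (bar u) x y ⟩
    bar u ∘ (x ∘ y)                          ≡⟨ ∘≡·lam (bar u) (x ∘ y) ⟩
    bar u · lam (bar u) (x ∘ y)              ≡⟨ cong (λ z → bar u · lam (bar u) z) (∘≡·lam x y) ⟩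
    bar u · lam (bar u) (x · u)              ≡⟨ cong (bar u ·_) (lam-· (bar u) x u) ⟩
    bar u · (lam (bar u) x · lam (bar u) u)  ≡⟨ ·.assoc _ _ _ ⟨
    bar u · lam (bar u) x · lam (bar u) u    ≡⟨ cong (λ z → z · lam (bar u) x · lam (bar u) u) (bar≡inv-lam u) ⟩
    conj (lam (bar u) u) (lam (bar u) x)     ≡⟨ lam-conj (bar u) u x ⟨
    lam (bar u) (conj u x)                   ∎
    where u = lam x y

module TwoReductive {ℓ} (S : SkewBrace ℓ) (R : SkewBrace.Is2Reductive S) where
  open SkewBrace S
  open SkewBraceProperties S
  open ≡-Reasoning

  lam-lam : ∀ x y → lam (lam x y) ≗ lam y
  lam-lam = proj₁ R

  lam-rho : ∀ x y → lam (rho x y) ≗ lam y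
  lam-rho = proj₁ (proj₂ (proj₂ R))

  rho-lam : ∀ x y → rho (lam x y) ≗ rho y
  rho-lam = proj₂ (proj₂ (proj₂ R))

  rho≡lam-bar-conj : ∀ y x → rho y x ≡ lam (bar y) (conj (lam x y) x)
  rho≡lam-bar-conj y x =
    trans (rho≡lam-conj y x) (lam-bar-cong (lam-lam x y) (conj (lam x y) x))

  conj-lam-lam : ∀ x y z → conj (lam z (lam x y)) z ≡ conj (lam z y) z
  conj-lam-lam x y z = lam-injective (bar y) (begin
    lam (bar y) (conj (lam z (lam x y)) z)          ≡⟨ lam-bar-cong (lam-lam x y) _ ⟨
    lam (bar (lam x y)) (conj (lam z (lam x y)) z)  ≡⟨ rho≡lam-bar-conj (lam x y) z ⟨
    rho (lam x y) z                                 ≡⟨ rho-lam x y z ⟩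
    rho y z                                         ≡⟨ rho≡lam-bar-conj y z ⟩
    lam (bar y) (conj (lam z y) z)                  ∎)

  -- conj-lam-lam applies to both sides once lam w y and y are written as lam v (lam _ y)
  conj-lam : ∀ w y → conj (lam w y) ≗ conj y
  conj-lam w y v = begin
    conj (lam w y) v                        ≡⟨ cong (λ z → conj z v) (lam-lam-bar v (lam w y)) ⟨
    conj (lam v (lam (bar v) (lam w y))) v  ≡⟨ cong (λ z → conj (lam v z) v) (lam-∘ (bar v) w y) ⟨
    conj (lam v (lam (bar v ∘ w) y)) v      ≡⟨ conj-lam-lam (bar v ∘ w) y v ⟩
    conj (lam v y) v                        ≡⟨ conj-lam-lam (bar v) y v ⟨
    conj (lam v (lam (bar v) y)) v          ≡⟨ cong (λ z → conj z v) (lam-lam-bar v y) ⟩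
    conj y v                                ∎

  lam-comm : ∀ w y → y · lam w y ≡ lam w y · y
  lam-comm w y = ·.conj-fixed⇒comm (lam w y) y (begin
    conj (lam w y) y   ≡⟨ conj-lam w y y ⟩
    inv y · y · y      ≡⟨ ·.assoc _ _ _ ⟩
    inv y · (y · y)    ≡⟨ ·.\\-leftDividesʳ y y ⟩
    y                  ∎)

  lam-inv≗lam-bar : ∀ y → lam (inv y) ≗ lam (bar y)
  lam-inv≗lam-bar y x = trans (cong (λ z → lam z x) (sym (lam-bar≡inv y))) (lam-lam y (bar y) x)

  lam-self : ∀ y → lam y y ≡ bar (inv y)
  lam-self y = ∘.inverseˡ-unique (lam y y) (inv y) (begin
    lam y y ∘ inv y                     ≡⟨ ∘≡·lam _ _ ⟩
    lam y y · lam (lam y y) (inv y)     ≡⟨ cong (lam y y ·_) (lam-lam y y (inv y)) ⟩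
    lam y y · lam y (inv y)             ≡⟨ cong (lam y y ·_) (lam-inv y y) ⟩
    lam y y · inv (lam y y)             ≡⟨ ·.inverseʳ _ ⟩
    e                                   ≡⟨ e∘≡e ⟨
    e∘                                  ∎)

  lam-∘-comm : ∀ x y → lam (x ∘ y) ≗ lam (y ∘ x)
  lam-∘-comm x y z = begin
    lam (x ∘ y) z               ≡⟨ lam-∘ x y z ⟩
    lam x (lam y z)             ≡⟨ lam-lam y x _ ⟨
    lam u (lam y z)             ≡⟨ cong (lam u) (lam-rho x y z) ⟨
    lam u (lam (rho x y) z)     ≡⟨ lam-∘ u (rho x y) z ⟨
    lam (u ∘ rho x y) z         ≡⟨ cong (λ t → lam t z) u∘rho≡y∘x ⟩
    lam (y ∘ x) z               ∎
    where
    u = lam y x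
    u∘rho≡y∘x : u ∘ rho x y ≡ y ∘ x
    u∘rho≡y∘x = trans (cong (u ∘_) (∘.assoc (bar u) y x)) (∘.\\-leftDividesˡ u (y ∘ x))

  ∘-self≡·-bar-inv : ∀ y → y ∘ y ≡ y · bar (inv y)
  ∘-self≡·-bar-inv y = trans (∘≡·lam y y) (cong (y ·_) (lam-self y))

  bar-∘-·-inv-bar≡conj : ∀ y x → (bar y ∘ x) · inv (bar y) ≡ conj y (lam (bar y) x)
  bar-∘-·-inv-bar≡conj y x = begin
    (bar y ∘ x) · inv (bar y)   ≡⟨ cong₂ _·_ (∘≡·lam (bar y) x) (inv-bar≡lam y) ⟩
    bar y · L · m               ≡⟨ cong (λ z → z · L · m) (bar≡inv-lam y) ⟩
    conj m L                    ≡⟨ conj-lam (bar y) y L ⟩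
    conj y L                    ∎
    where
    m = lam (bar y) y
    L = lam (bar y) x

  inv-∘-·≡bar-∘-·-inv-bar : ∀ y x → (inv y ∘ x) · y ≡ (bar y ∘ x) · inv (bar y)
  inv-∘-·≡bar-∘-·-inv-bar y x = begin
    (inv y ∘ x) · y                  ≡⟨ cong (_· y) (∘≡·lam (inv y) x) ⟩
    inv y · lam (inv y) x · y        ≡⟨ cong (λ z → inv y · z · y) (lam-inv≗lam-bar y x) ⟩
    conj y (lam (bar y) x)           ≡⟨ bar-∘-·-inv-bar≡conj y x ⟨
    (bar y ∘ x) · inv (bar y)        ∎

  bar-∘-·-inv-bar≡rho : ∀ y x → (bar y ∘ x) · inv (bar y) ≡ rho y x
  bar-∘-·-inv-bar≡rho y x = begin
    (bar y ∘ x) · inv (bar y)                  ≡⟨ bar-∘-·-inv-bar≡conj y x ⟩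
    conj y (lam (bar y) x)                     ≡⟨ conj-lam (bar y) y _ ⟨
    conj (lam (bar y) y) (lam (bar y) x)       ≡⟨ lam-conj (bar y) y x ⟨
    lam (bar y) (conj y x)                     ≡⟨ cong (lam (bar y)) (conj-lam x y x) ⟨
    lam (bar y) (conj (lam x y) x)             ≡⟨ rho≡lam-bar-conj y x ⟨
    rho y x                                    ∎

  bar-·-comm : ∀ y → bar y · y ≡ y · bar y
  bar-·-comm y = begin
    bar y · y          ≡⟨ cong (_· y) (bar≡inv-lam y) ⟩
    inv m · y          ≡⟨ ·.comm⇒comm-inverse y m (lam-comm (bar y) y) ⟩
    y · inv m          ≡⟨ cong (y ·_) (bar≡inv-lam y) ⟨
    y · bar y          ∎
    where m = lam (bar y) y

  inv-·-inv-bar≡inv-∘ : ∀ y → inv y · inv (bar y) ≡ inv y ∘ y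
  inv-·-inv-bar≡inv-∘ y = begin
    inv y · inv (bar y)         ≡⟨ cong (inv y ·_) (inv-bar≡lam y) ⟩
    inv y · lam (bar y) y       ≡⟨ cong (inv y ·_) (lam-inv≗lam-bar y y) ⟨
    inv y · lam (inv y) y       ≡⟨ ∘≡·lam (inv y) y ⟨
    inv y ∘ y                   ∎

  ∘-self≡bar-inv-∘-inv-bar : ∀ y → y ∘ y ≡ bar (inv y) ∘ inv (bar y)
  ∘-self≡bar-inv-∘-inv-bar y = begin
    y ∘ y                                   ≡⟨ ∘≡·lam y y ⟩
    y · lam y y                             ≡⟨ lam-comm y y ⟩
    lam y y · y                             ≡⟨ cong (lam y y ·_) (·.⁻¹-involutive y) ⟨
    lam y y · inv (inv y)                   ≡⟨ cong (λ z → lam y y · inv z) (lam-bar≡inv y) ⟨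
    lam y y · inv (lam y (bar y))           ≡⟨ cong (lam y y ·_) (lam-inv y (bar y)) ⟨
    lam y y · lam y (inv (bar y))           ≡⟨ cong (lam y y ·_) (lam-lam y y _) ⟨
    lam y y · lam (lam y y) (inv (bar y))   ≡⟨ ∘≡·lam _ _ ⟨
    lam y y ∘ inv (bar y)                   ≡⟨ cong (_∘ inv (bar y)) (lam-self y) ⟩
    bar (inv y) ∘ inv (bar y)               ∎

  inv-bar-·≡inv-∘ : ∀ y → inv (bar y · y) ≡ inv y ∘ y
  inv-bar-·≡inv-∘ y = trans (·.⁻¹-anti-homo-∙ (bar y) y) (inv-·-inv-bar≡inv-∘ y)

  bar-bar-·≡inv-bar-· : ∀ y → bar (bar y · y) ≡ inv (bar y · y)
  bar-bar-·≡inv-bar-· y = ∘.⁻¹-selfInverse (begin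
    bar (inv (bar y · y))           ≡⟨ cong bar (inv-bar-·≡inv-∘ y) ⟩
    bar (inv y ∘ y)                 ≡⟨ ∘.⁻¹-anti-homo-∙ (inv y) y ⟩
    bar y ∘ bar (inv y)             ≡⟨ cong (bar y ∘_) (lam-self y) ⟨
    bar y ∘ lam y y                 ≡⟨ ∘≡·lam _ _ ⟩
    bar y · lam (bar y) (lam y y)   ≡⟨ cong (bar y ·_) (lam-bar-lam y y) ⟩
    bar y · y                       ∎)

  ∘-commutator : ∀ x y → x ∘ y ∘ bar x ∘ bar y ≡ (x ∘ y) · inv (y ∘ x)
  ∘-commutator x y = begin
    x ∘ y ∘ bar x ∘ bar y                      ≡⟨ ∘.assoc _ _ _ ⟩
    (x ∘ y) ∘ (bar x ∘ bar y)                  ≡⟨ cong ((x ∘ y) ∘_) (∘.⁻¹-anti-homo-∙ y x) ⟨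
    (x ∘ y) ∘ bar (y ∘ x)                      ≡⟨ ∘≡·lam _ _ ⟩
    (x ∘ y) · lam (x ∘ y) (bar (y ∘ x))        ≡⟨ cong ((x ∘ y) ·_) (lam-∘-comm x y _) ⟩
    (x ∘ y) · lam (y ∘ x) (bar (y ∘ x))        ≡⟨ cong ((x ∘ y) ·_) (lam-bar≡inv _) ⟩
    (x ∘ y) · inv (y ∘ x)                      ∎

lemma6p3 : {ℓ : Level} (S : SkewBrace ℓ) → SkewBrace.Is2Reductive S →
    let open SkewBrace S in
    ∀ x y →
      (y ∘ y ≡ y · bar (inv y))
      × (((inv y ∘ x) · y ≡ (bar y ∘ x) · inv (bar y))
         × ((bar y ∘ x) · inv (bar y) ≡ rho y x))
      × (bar y · y ≡ y · bar y)
      × (inv y · inv (bar y) ≡ inv y ∘ y)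
      × (y ∘ y ≡ bar (inv y) ∘ inv (bar y))
      × ((bar (bar y · y) ≡ inv (bar y · y)) × (inv (bar y · y) ≡ inv y ∘ y))
      × (x ∘ y ∘ bar x ∘ bar y ≡ (x ∘ y) · inv (y ∘ x))
lemma6p3 S R x y =
    ∘-self≡·-bar-inv y
  , (inv-∘-·≡bar-∘-·-inv-bar y x , bar-∘-·-inv-bar≡rho y x)
  , bar-·-comm y
  , inv-·-inv-bar≡inv-∘ y
  , ∘-self≡bar-inv-∘-inv-bar y
  , (bar-bar-·≡inv-bar-· y , inv-bar-·≡inv-∘ y)
  , ∘-commutator x y
  where open TwoReductive S R
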